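{- Let $s,t$ be positive integers, let $M$ be an $(s,t)$-spike of order $m\ge 3\max\{s,t\}-2$, and let $X\subseteq E(M)$ with $|X|\le 2\min\{s,t\}-1$. Then $\lambda(X)=|X|$.
   Context: For positive integers $s,t$, an $(s,t)$-spike of order $m$ is a matroid $M$ with $m\ge\max\{s,t\}$ together with an associated partition $(A_1,\dots,A_m)$ of $E(M)$ into $2$-element sets (arms) such that the union of any $s$ arms is a circuit of $M$ and the union of any $t$ arms is a cocircuit of $M$. The connectivity function of $M$ is $\lambda(X)=r(X)+r(E(M)-X)-r(M)$ for $X\subseteq E(M)$. -}

module Defs where

open import Data.Nat using (ℕ; _+_; _∸_; _≤_; _<_)
open import Data.Fin using (Fin)
open import Data.Fin.Subset using (Subset; _⊆_; _∪_; _∩_; ∁; ⊤; ∣_∣; ⁅_⁆; _∈_)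
open import Data.Vec using (tabulate; lookup)
open import Data.Product using (_×_)
open import Relation.Nullary using (¬_)
open import Relation.Binary.PropositionalEquality using (_≡_)

record Matroid (n : ℕ) : Set where
  field
    rank      : Subset n → ℕ
    rank-bound : ∀ X → rank X ≤ ∣ X ∣
    rank-mono  : ∀ X Y → X ⊆ Y → rank X ≤ rank Y
    rank-submod : ∀ X Y → rank (X ∪ Y) + rank (X ∩ Y) ≤ rank X + rank Y

open Matroid public

corank : ∀ {n} → Matroid n → Subset n → ℕ
corank M X = ∣ X ∣ + rank M (∁ X) ∸ rank M ⊤

IsCircuitFor : ∀ {n} → (Subset n → ℕ) → Subset n → Set
IsCircuitFor r C = (r C < ∣ C ∣) × (∀ Y → Y ⊆ C → ¬ (Y ≡ C) → r Y ≡ ∣ Y ∣)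

IsCircuit : ∀ {n} → Matroid n → Subset n → Set
IsCircuit M = IsCircuitFor (rank M)

IsCocircuit : ∀ {n} → Matroid n → Subset n → Set
IsCocircuit M = IsCircuitFor (corank M)

conn : ∀ {n} → Matroid n → Subset n → ℕ
conn M X = rank M X + rank M (∁ X) ∸ rank M ⊤

armUnion : ∀ {n m} → (Fin n → Fin m) → Subset m → Subset n
armUnion arm S = tabulate (λ e → lookup S (arm e))

-- (s,t)-spike of order m: the arms (fibres of arm) partition E into
-- 2-element sets, m ≥ s, m ≥ t, any s arms form a circuit, any t arms a cocircuit.
record IsSpike {n : ℕ} (s t m : ℕ) (M : Matroid n) (arm : Fin n → Fin m) : Set where
  field
    s≤m : s ≤ m
    t≤m : t ≤ m
    arm-size : ∀ i → ∣ armUnion arm ⁅ i ⁆ ∣ ≡ 2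
    circuits : ∀ (S : Subset m) → ∣ S ∣ ≡ s → IsCircuit M (armUnion arm S)
    cocircuits : ∀ (S : Subset m) → ∣ S ∣ ≡ t → IsCocircuit M (armUnion arm S)

-- Every Y ⊆ X is independent and coindependent, so λ(X) = |X| + r(M) − r(M). Both facts are proved by
-- induction on |Y|, dually to each other. If Y is a union of arms, it uses fewer than min(s,t) arms
-- because |Y| < 2 min(s,t), so it lies properly inside a union of s arms (a circuit) and of t arms (a
-- cocircuit). Otherwise some arm meets Y in a single element e; as m ≥ |Y| + max(s,t) − 1, the arm of e
-- can be completed by arms missing Y to a cocircuit D (t arms) and to a circuit C (s arms) meeting Y
-- only in e. Submodularity of r on (E − D, Y) then gives r(Y − e) < r(Y), and on (E − Y, C) it shows
-- that E − Y spans as soon as E − (Y − e) does.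
module Submission where

open import Data.Bool using (_∧_)
open import Data.Fin using (Fin; zero; suc; _≟_)
open import Data.Fin.Subset
open import Data.Fin.Subset.Properties
open import Data.Nat using (ℕ; zero; suc; pred; _+_; _*_; _∸_; _≤_; _<_; _⊔_; _⊓_; z≤n; s≤s; s≤s⁻¹; z<s)
open import Data.Nat.Properties hiding (_≟_)
open import Data.Product using (∃; _×_; _,_; proj₁; proj₂)
open import Data.Sum using (_⊎_; inj₁; inj₂)
open import Data.Vec using (_∷_; []; here; there; lookup; zipWith)
open import Data.Vec.Properties using (lookup∘tabulate; tabulate∘lookup; tabulate-cong; lookup-zipWith; []=⇒lookup; lookup⇒[]=)
open import Function using (id; _∘_)
open import Relation.Nullary using (yes; no; contradiction)
open import Relation.Binary.PropositionalEquality

open import Defs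

m+n∸o<m⇒n<o : ∀ m n o → m + n ∸ o < m → n < o
m+n∸o<m⇒n<o m n o lt = ≰⇒> λ o≤n → <⇒≱ lt (begin
  m            ≤⟨ m≤m+n m (n ∸ o) ⟩
  m + (n ∸ o)  ≡⟨ +-∸-assoc m o≤n ⟨
  m + n ∸ o    ∎)
  where open ≤-Reasoning

m+n∸o≡m⇒o≤n : ∀ m n o → 0 < m → m + n ∸ o ≡ m → o ≤ n
m+n∸o≡m⇒o≤n (suc m) n o _ eq = ≮⇒≥ λ n<o → <-irrefl eq (begin-strict
  suc m + n ∸ o           ≤⟨ ∸-monoʳ-≤ (suc m + n) n<o ⟩
  suc m + n ∸ suc n       ≡⟨ pred[m∸n]≡m∸[1+n] (suc m + n) n ⟨
  pred (suc m + n ∸ n)    ≡⟨ cong pred (m+n∸n≡m (suc m) n) ⟩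
  m                       <⟨ n<1+n m ⟩
  suc m                   ∎)
  where open ≤-Reasoning

m≤n∸1⇒m<n : ∀ {m n} → 0 < n → m ≤ n ∸ 1 → m < n
m≤n∸1⇒m<n {n = suc n} _ m≤n = s≤s m≤n

size-bounds : ∀ {lo hi s t m b} → 1 ≤ lo → lo ≤ s → lo ≤ hi → t ≤ hi → 3 * hi ∸ 2 ≤ m →
              b ≤ 2 * lo ∸ 1 → b < 2 * s × b + t ≤ suc m
size-bounds {lo} {hi} {_} {t} {m} {b} 1≤lo lo≤s lo≤hi t≤hi 3hi-2≤m b≤2lo-1 =
  <-≤-trans b<2lo (*-monoʳ-≤ 2 lo≤s) , s≤s⁻¹ (begin
    suc b + t          ≤⟨ +-mono-≤ b<2lo t≤hi ⟩
    2 * lo + hi        ≤⟨ +-monoˡ-≤ hi (*-monoʳ-≤ 2 lo≤hi) ⟩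
    2 * hi + hi        ≡⟨ +-comm (2 * hi) hi ⟩
    3 * hi             ≤⟨ m≤n+m∸n (3 * hi) 2 ⟩
    2 + (3 * hi ∸ 2)   ≤⟨ +-monoʳ-≤ 2 3hi-2≤m ⟩
    2 + m              ∎)
  where
  open ≤-Reasoning
  b<2lo : b < 2 * lo
  b<2lo = m≤n∸1⇒m<n (<-≤-trans z<s (*-monoʳ-≤ 2 1≤lo)) b≤2lo-1

∣p∣≡∣p∩q∣+∣p─q∣ : ∀ {n} (p q : Subset n) → ∣ p ∣ ≡ ∣ p ∩ q ∣ + ∣ p ─ q ∣
∣p∣≡∣p∩q∣+∣p─q∣ []            []            = refl
∣p∣≡∣p∩q∣+∣p─q∣ (inside ∷ p)  (inside ∷ q)  = cong suc (∣p∣≡∣p∩q∣+∣p─q∣ p q)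
∣p∣≡∣p∩q∣+∣p─q∣ (inside ∷ p)  (outside ∷ q) = trans (cong suc (∣p∣≡∣p∩q∣+∣p─q∣ p q)) (sym (+-suc _ _))
∣p∣≡∣p∩q∣+∣p─q∣ (outside ∷ p) (inside ∷ q)  = ∣p∣≡∣p∩q∣+∣p─q∣ p q
∣p∣≡∣p∩q∣+∣p─q∣ (outside ∷ p) (outside ∷ q) = ∣p∣≡∣p∩q∣+∣p─q∣ p q

x∈p─q⇒x∉q : ∀ {n} {x : Fin n} (p q : Subset n) → x ∈ p ─ q → x ∉ q
x∈p─q⇒x∉q (inside ∷ p) (outside ∷ q) here      = λ ()
x∈p─q⇒x∉q (_ ∷ p)      (inside ∷ q)  (there h) = x∈p─q⇒x∉q p q h ∘ drop-there
x∈p─q⇒x∉q (_ ∷ p)      (outside ∷ q) (there h) = x∈p─q⇒x∉q p q h ∘ drop-there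

∣p∪q∣≤∣p∣+∣q∣ : ∀ {n} (p q : Subset n) → ∣ p ∪ q ∣ ≤ ∣ p ∣ + ∣ q ∣
∣p∪q∣≤∣p∣+∣q∣ p q = begin
  ∣ p ∪ q ∣
    ≡⟨ ∣p∣≡∣p∩q∣+∣p─q∣ (p ∪ q) p ⟩
  ∣ (p ∪ q) ∩ p ∣ + ∣ (p ∪ q) ─ p ∣
    ≤⟨ +-mono-≤ (p⊆q⇒∣p∣≤∣q∣ (p∩q⊆q (p ∪ q) p)) (p⊆q⇒∣p∣≤∣q∣ [p∪q]─p⊆q) ⟩
  ∣ p ∣ + ∣ q ∣
    ∎
  where
  open ≤-Reasoning
  [p∪q]─p⊆q : (p ∪ q) ─ p ⊆ q
  [p∪q]─p⊆q x∈ with x∈p∪q⁻ p q (p─q⊆p (p ∪ q) p x∈)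
  ... | inj₁ x∈p = contradiction x∈p (x∈p─q⇒x∉q (p ∪ q) p x∈)
  ... | inj₂ x∈q = x∈q

x∈p-y⇒x≢y : ∀ {n} {x y : Fin n} {p : Subset n} → x ∈ p - y → x ≢ y
x∈p-y⇒x≢y {y = y} {p} x∈p-y refl = x∈p─q⇒x∉q p ⁅ y ⁆ x∈p-y (x∈⁅x⁆ y)

x∈p⇒∣p∣≡1+∣p-x∣ : ∀ {n} {x : Fin n} {p : Subset n} → x ∈ p → ∣ p ∣ ≡ suc ∣ p - x ∣
x∈p⇒∣p∣≡1+∣p-x∣ {p = inside ∷ p}  here      = cong suc (sym (cong ∣_∣ (p─⊥≡p p)))
x∈p⇒∣p∣≡1+∣p-x∣ {p = inside ∷ p}  (there h) = cong suc (x∈p⇒∣p∣≡1+∣p-x∣ h)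
x∈p⇒∣p∣≡1+∣p-x∣ {p = outside ∷ p} (there h) = x∈p⇒∣p∣≡1+∣p-x∣ h

x∈p⇒0<∣p∣ : ∀ {n} {x : Fin n} {p : Subset n} → x ∈ p → 0 < ∣ p ∣
x∈p⇒0<∣p∣ x∈p = ≤-<-trans z≤n (x∈p⇒∣p-x∣<∣p∣ x∈p)

∣p∣≡0⇒x∉p : ∀ {n} {x : Fin n} {p : Subset n} → ∣ p ∣ ≡ 0 → x ∉ p
∣p∣≡0⇒x∉p ∣p∣≡0 x∈p = <-irrefl (sym ∣p∣≡0) (x∈p⇒0<∣p∣ x∈p)

x∈p⇒p∩⁅x⁆≡⁅x⁆ : ∀ {n} {x : Fin n} {p : Subset n} → x ∈ p → p ∩ ⁅ x ⁆ ≡ ⁅ x ⁆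
x∈p⇒p∩⁅x⁆≡⁅x⁆ {x = x} {p} x∈p = ⊆-antisym (p∩q⊆q p ⁅ x ⁆)
  (λ y∈⁅x⁆ → x∈p∩q⁺ (subst (_∈ p) (sym (x∈⁅y⁆⇒x≡y x y∈⁅x⁆)) x∈p , y∈⁅x⁆))

p-x⊆∁q⇒q-x⊆∁p : ∀ {n} {x : Fin n} {p q : Subset n} → p - x ⊆ ∁ q → q - x ⊆ ∁ p
p-x⊆∁q⇒q-x⊆∁p {q = q} p-x⊆∁q y∈q-x = x∉p⇒x∈∁p λ y∈p →
  x∈∁p⇒x∉p (p-x⊆∁q (x∈p∧x≢y⇒x∈p-y y∈p (x∈p-y⇒x≢y y∈q-x))) (p─q⊆p q _ y∈q-x)

∁[p-x]⊆∁p∪q : ∀ {n} {x : Fin n} {p q : Subset n} → x ∈ q → ∁ (p - x) ⊆ ∁ p ∪ q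
∁[p-x]⊆∁p∪q {x = x} x∈q {y} y∈∁[p-x] with y ≟ x
... | yes refl = x∈p∪q⁺ (inj₂ x∈q)
... | no y≢x   = x∈p∪q⁺ (inj₁ (x∉p⇒x∈∁p λ y∈p → x∈∁p⇒x∉p y∈∁[p-x] (x∈p∧x≢y⇒x∈p-y y∈p y≢x)))

∣p∣≡2⇒z≡y : ∀ {n} {p : Subset n} {x y z : Fin n} → ∣ p ∣ ≡ 2 →
            x ∈ p → y ∈ p → z ∈ p → y ≢ x → z ≢ x → z ≡ y
∣p∣≡2⇒z≡y {p = p} {x} {y} {z} ∣p∣≡2 x∈p y∈p z∈p y≢x z≢x with z ≟ y
... | yes z≡y = z≡y
... | no z≢y  = contradiction (x∈p∧x≢y⇒x∈p-y (x∈p∧x≢y⇒x∈p-y z∈p z≢x) z≢y) (∣p∣≡0⇒x∉p ∣p-x-y∣≡0)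
  where
  ∣p-x-y∣≡0 : ∣ p - x - y ∣ ≡ 0
  ∣p-x-y∣≡0 = suc-injective (trans (sym (x∈p⇒∣p∣≡1+∣p-x∣ (x∈p∧x≢y⇒x∈p-y y∈p y≢x)))
                                  (suc-injective (trans (sym (x∈p⇒∣p∣≡1+∣p-x∣ x∈p)) ∣p∣≡2)))

⊆-or-∃∉ : ∀ {n} (p q : Subset n) → p ⊆ q ⊎ ∃ λ x → x ∈ p × x ∉ q
⊆-or-∃∉ []            []            = inj₁ id
⊆-or-∃∉ (inside ∷ p)  (outside ∷ q) = inj₂ (zero , here , λ ())
⊆-or-∃∉ (inside ∷ p)  (inside ∷ q)  with ⊆-or-∃∉ p q
... | inj₁ p⊆q             = inj₁ (in⊆in p⊆q)
... | inj₂ (x , x∈p , x∉q) = inj₂ (suc x , there x∈p , x∉q ∘ drop-there)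
⊆-or-∃∉ (outside ∷ p) (_ ∷ q)       with ⊆-or-∃∉ p q
... | inj₁ p⊆q             = inj₁ (out⊆ p⊆q)
... | inj₂ (x , x∈p , x∉q) = inj₂ (suc x , there x∈p , x∉q ∘ drop-there)

∣p∣<∣q∣⇒∃∈q∉p : ∀ {n} (p q : Subset n) → ∣ p ∣ < ∣ q ∣ → ∃ λ x → x ∈ q × x ∉ p
∣p∣<∣q∣⇒∃∈q∉p p q ∣p∣<∣q∣ with ⊆-or-∃∉ q p
... | inj₁ q⊆p = contradiction (p⊆q⇒∣p∣≤∣q∣ q⊆p) (<⇒≱ ∣p∣<∣q∣)
... | inj₂ x∈q∖p = x∈q∖p

0<∣p∣⇒Nonempty : ∀ {n} (p : Subset n) → 0 < ∣ p ∣ → Nonempty p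
0<∣p∣⇒Nonempty {n} p 0<∣p∣ with ∣p∣<∣q∣⇒∃∈q∉p ⊥ p (subst (_< ∣ p ∣) (sym (∣⊥∣≡0 n)) 0<∣p∣)
... | x , x∈p , _ = x , x∈p

⊆-extend : ∀ {n} {p q : Subset n} k → p ⊆ q → ∣ p ∣ ≤ k → k ≤ ∣ q ∣ →
           ∃ λ r → p ⊆ r × r ⊆ q × ∣ r ∣ ≡ k
⊆-extend {p = []} {[]} k _ _ k≤0 = [] , id , id , sym (n≤0⇒n≡0 k≤0)
⊆-extend {p = inside ∷ p} {outside ∷ q} k p⊆q = contradiction (p⊆q here) λ ()
⊆-extend {p = inside ∷ p} {inside ∷ q} (suc k) p⊆q (s≤s ∣p∣≤k) (s≤s k≤∣q∣)
  with ⊆-extend k (drop-∷-⊆ p⊆q) ∣p∣≤k k≤∣q∣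
... | r , p⊆r , r⊆q , ∣r∣≡k = inside ∷ r , in⊆in p⊆r , in⊆in r⊆q , cong suc ∣r∣≡k
⊆-extend {p = outside ∷ p} {outside ∷ q} k p⊆q ∣p∣≤k k≤∣q∣
  with ⊆-extend k (drop-∷-⊆ p⊆q) ∣p∣≤k k≤∣q∣
... | r , p⊆r , r⊆q , ∣r∣≡k = outside ∷ r , out⊆ p⊆r , out⊆ r⊆q , ∣r∣≡k
⊆-extend {p = outside ∷ p} {inside ∷ q} k p⊆q ∣p∣≤k k≤1+∣q∣ with k ≤? ∣ q ∣
... | yes k≤∣q∣ with ⊆-extend k (drop-∷-⊆ p⊆q) ∣p∣≤k k≤∣q∣
...   | r , p⊆r , r⊆q , ∣r∣≡k = outside ∷ r , out⊆ p⊆r , out⊆ r⊆q , ∣r∣≡k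
⊆-extend {p = outside ∷ p} {inside ∷ q} k p⊆q ∣p∣≤k k≤1+∣q∣
    | no k≰∣q∣ = inside ∷ q , p⊆q , id , ≤-antisym (≰⇒> k≰∣q∣) k≤1+∣q∣

subset-induction : ∀ {n ℓ} (P : Subset n → Set ℓ) →
                   (∀ p → (∀ {x} → x ∈ p → P (p - x)) → P p) → ∀ p → P p
subset-induction P step p = by-size ∣ p ∣ p refl
  where
  by-size : ∀ k p → ∣ p ∣ ≡ k → P p
  by-size zero    p ∣p∣≡0   = step p λ x∈p → contradiction x∈p (∣p∣≡0⇒x∉p ∣p∣≡0)
  by-size (suc k) p ∣p∣≡1+k = step p λ x∈p →
    by-size k _ (suc-injective (trans (sym (x∈p⇒∣p∣≡1+∣p-x∣ x∈p)) ∣p∣≡1+k))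

image : ∀ {n m} → (Fin n → Fin m) → Subset n → Subset m
image f []            = ⊥
image f (inside ∷ p)  = ⁅ f zero ⁆ ∪ image (f ∘ suc) p
image f (outside ∷ p) = image (f ∘ suc) p

∈-image⁺ : ∀ {n m} (f : Fin n → Fin m) {x p} → x ∈ p → f x ∈ image f p
∈-image⁺ f {p = inside ∷ p}  here      = x∈p∪q⁺ (inj₁ (x∈⁅x⁆ (f zero)))
∈-image⁺ f {p = inside ∷ p}  (there h) = x∈p∪q⁺ (inj₂ (∈-image⁺ (f ∘ suc) h))
∈-image⁺ f {p = outside ∷ p} (there h) = ∈-image⁺ (f ∘ suc) h

∈-image⁻ : ∀ {n m} (f : Fin n → Fin m) {y} p → y ∈ image f p → ∃ λ x → x ∈ p × f x ≡ y
∈-image⁻ f []            y∈ = contradiction y∈ ∉⊥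
∈-image⁻ f (inside ∷ p)  y∈ with x∈p∪q⁻ ⁅ f zero ⁆ _ y∈
... | inj₁ y∈⁅f0⁆ = zero , here , sym (x∈⁅y⁆⇒x≡y _ y∈⁅f0⁆)
... | inj₂ y∈img with ∈-image⁻ (f ∘ suc) p y∈img
...   | x , x∈p , fx≡y = suc x , there x∈p , fx≡y
∈-image⁻ f (outside ∷ p) y∈ with ∈-image⁻ (f ∘ suc) p y∈
... | x , x∈p , fx≡y = suc x , there x∈p , fx≡y

∣image∣≤∣p∣ : ∀ {n m} (f : Fin n → Fin m) p → ∣ image f p ∣ ≤ ∣ p ∣
∣image∣≤∣p∣ {m = m} f []  = ≤-reflexive (∣⊥∣≡0 m)
∣image∣≤∣p∣ f (inside ∷ p) = begin
  ∣ ⁅ f zero ⁆ ∪ image (f ∘ suc) p ∣       ≤⟨ ∣p∪q∣≤∣p∣+∣q∣ ⁅ f zero ⁆ _ ⟩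
  ∣ ⁅ f zero ⁆ ∣ + ∣ image (f ∘ suc) p ∣   ≡⟨ cong (_+ ∣ image (f ∘ suc) p ∣) (∣⁅x⁆∣≡1 (f zero)) ⟩
  suc ∣ image (f ∘ suc) p ∣                ≤⟨ s≤s (∣image∣≤∣p∣ (f ∘ suc) p) ⟩
  suc ∣ p ∣                                ∎
  where open ≤-Reasoning
∣image∣≤∣p∣ f (outside ∷ p) = ∣image∣≤∣p∣ (f ∘ suc) p

module Arms {n m : ℕ} (arm : Fin n → Fin m) where

  ∈-armUnion⁺ : ∀ {S x} → arm x ∈ S → x ∈ armUnion arm S
  ∈-armUnion⁺ {S} {x} arm-x∈S = lookup⇒[]= x (armUnion arm S) (trans (lookup∘tabulate _ x) ([]=⇒lookup arm-x∈S))

  ∈-armUnion⁻ : ∀ {S x} → x ∈ armUnion arm S → arm x ∈ S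
  ∈-armUnion⁻ {S} {x} x∈ = lookup⇒[]= (arm x) S (trans (sym (lookup∘tabulate _ x)) ([]=⇒lookup x∈))

  armUnion-zipWith : ∀ f S T → armUnion arm (zipWith f S T) ≡ zipWith f (armUnion arm S) (armUnion arm T)
  armUnion-zipWith f S T = trans (tabulate-cong pointwise) (tabulate∘lookup _)
    where
    open ≡-Reasoning
    pointwise : ∀ x → lookup (zipWith f S T) (arm x) ≡ lookup (zipWith f (armUnion arm S) (armUnion arm T)) x
    pointwise x = begin
      lookup (zipWith f S T) (arm x)
        ≡⟨ lookup-zipWith f (arm x) S T ⟩
      f (lookup S (arm x)) (lookup T (arm x))
        ≡⟨ cong₂ f (lookup∘tabulate _ x) (lookup∘tabulate _ x) ⟨
      f (lookup (armUnion arm S) x) (lookup (armUnion arm T) x)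
        ≡⟨ lookup-zipWith f x (armUnion arm S) (armUnion arm T) ⟨
      lookup (zipWith f (armUnion arm S) (armUnion arm T)) x
        ∎

  armUnion-∩ : ∀ S T → armUnion arm (S ∩ T) ≡ armUnion arm S ∩ armUnion arm T
  armUnion-∩ = armUnion-zipWith _∧_

  armUnion-─ : ∀ S T → armUnion arm (S ─ T) ≡ armUnion arm S ─ armUnion arm T
  armUnion-─ S T = armUnion-zipWith _ S T

  ∣armUnion∣≡c*∣S∣ : ∀ {c} → (∀ i → ∣ armUnion arm ⁅ i ⁆ ∣ ≡ c) → ∀ S → ∣ armUnion arm S ∣ ≡ c * ∣ S ∣
  ∣armUnion∣≡c*∣S∣ {c} ∣arm∣≡c = subset-induction _ step
    where
    open ≡-Reasoning
    step : ∀ S → (∀ {i} → i ∈ S → ∣ armUnion arm (S - i) ∣ ≡ c * ∣ S - i ∣) → ∣ armUnion arm S ∣ ≡ c * ∣ S ∣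
    step S ih with nonempty? S
    ... | no S-empty = begin
      ∣ armUnion arm S ∣  ≡⟨ cong ∣_∣ (Empty-unique λ (x , x∈) → S-empty (arm x , ∈-armUnion⁻ {S} x∈)) ⟩
      ∣ ⊥ {n} ∣           ≡⟨ ∣⊥∣≡0 n ⟩
      0                   ≡⟨ *-zeroʳ c ⟨
      c * 0               ≡⟨ cong (c *_) (trans (cong ∣_∣ (Empty-unique S-empty)) (∣⊥∣≡0 m)) ⟨
      c * ∣ S ∣           ∎
    ... | yes (i , i∈S) = begin
      ∣ armUnion arm S ∣
        ≡⟨ ∣p∣≡∣p∩q∣+∣p─q∣ (armUnion arm S) (armUnion arm ⁅ i ⁆) ⟩
      ∣ armUnion arm S ∩ armUnion arm ⁅ i ⁆ ∣ + ∣ armUnion arm S ─ armUnion arm ⁅ i ⁆ ∣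
        ≡⟨ cong₂ (λ X Y → ∣ X ∣ + ∣ Y ∣) (armUnion-∩ S ⁅ i ⁆) (armUnion-─ S ⁅ i ⁆) ⟨
      ∣ armUnion arm (S ∩ ⁅ i ⁆) ∣ + ∣ armUnion arm (S - i) ∣
        ≡⟨ cong (λ X → ∣ armUnion arm X ∣ + ∣ armUnion arm (S - i) ∣) (x∈p⇒p∩⁅x⁆≡⁅x⁆ i∈S) ⟩
      ∣ armUnion arm ⁅ i ⁆ ∣ + ∣ armUnion arm (S - i) ∣
        ≡⟨ cong₂ _+_ (∣arm∣≡c i) (ih i∈S) ⟩
      c + c * ∣ S - i ∣
        ≡⟨ *-suc c ∣ S - i ∣ ⟨
      c * suc ∣ S - i ∣
        ≡⟨ cong (c *_) (x∈p⇒∣p∣≡1+∣p-x∣ i∈S) ⟨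
      c * ∣ S ∣
        ∎

  UnionOfArms : Subset n → Set
  UnionOfArms Y = armUnion arm (image arm Y) ⊆ Y

  SplitsArm : Subset n → Set
  SplitsArm Y = ∃ λ e → e ∈ Y × ∃ λ z → arm z ≡ arm e × z ∉ Y

  unionOfArms⊎splitsArm : ∀ Y → UnionOfArms Y ⊎ SplitsArm Y
  unionOfArms⊎splitsArm Y with ⊆-or-∃∉ (armUnion arm (image arm Y)) Y
  ... | inj₁ Y-union = inj₁ Y-union
  ... | inj₂ (z , z∈ , z∉Y) with ∈-image⁻ arm Y (∈-armUnion⁻ {image arm Y} z∈)
  ...   | e , e∈Y , arm-e≡arm-z = inj₂ (e , e∈Y , z , sym arm-e≡arm-z , z∉Y)

module ArmPairs {n m : ℕ} {arm : Fin n → Fin m} (∣arm∣≡2 : ∀ i → ∣ armUnion arm ⁅ i ⁆ ∣ ≡ 2) where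
  open Arms arm

  partner-unique : ∀ {e y z} → arm y ≡ arm e → arm z ≡ arm e → y ≢ e → z ≢ e → z ≡ y
  partner-unique {e} arm-y≡arm-e arm-z≡arm-e =
    ∣p∣≡2⇒z≡y (∣arm∣≡2 (arm e)) (in-arm-e refl) (in-arm-e arm-y≡arm-e) (in-arm-e arm-z≡arm-e)
    where
    in-arm-e : ∀ {x} → arm x ≡ arm e → x ∈ armUnion arm ⁅ arm e ⁆
    in-arm-e arm-x≡arm-e = ∈-armUnion⁺ (subst (_∈ ⁅ arm e ⁆) (sym arm-x≡arm-e) (x∈⁅x⁆ (arm e)))

  ∣image∣<k : ∀ {k} Y → UnionOfArms Y → ∣ Y ∣ < 2 * k → ∣ image arm Y ∣ < k
  ∣image∣<k {k} Y Y-union ∣Y∣<2k = *-cancelˡ-< 2 _ _ (begin-strict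
    2 * ∣ image arm Y ∣             ≡⟨ ∣armUnion∣≡c*∣S∣ ∣arm∣≡2 (image arm Y) ⟨
    ∣ armUnion arm (image arm Y) ∣  ≤⟨ p⊆q⇒∣p∣≤∣q∣ Y-union ⟩
    ∣ Y ∣                           <⟨ ∣Y∣<2k ⟩
    2 * k                           ∎)
    where open ≤-Reasoning

  unionOfArms⊂armUnion : ∀ {k} Y → UnionOfArms Y → ∣ Y ∣ < 2 * k → k ≤ m →
                         ∃ λ S → ∣ S ∣ ≡ k × Y ⊂ armUnion arm S
  unionOfArms⊂armUnion {k} Y Y-union ∣Y∣<2k k≤m =
    let S , B⊆S , _ , ∣S∣≡k = ⊆-extend k ⊆⊤ (<⇒≤ ∣B∣<k) (subst (k ≤_) (sym (∣⊤∣≡n m)) k≤m)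
        i , i∈S , i∉B       = ∣p∣<∣q∣⇒∃∈q∉p B S (subst (∣ B ∣ <_) (sym ∣S∣≡k) ∣B∣<k)
        z , z∈arm-i         = 0<∣p∣⇒Nonempty (armUnion arm ⁅ i ⁆) (subst (0 <_) (sym (∣arm∣≡2 i)) z<s)
        arm-z≡i             = x∈⁅y⁆⇒x≡y i (∈-armUnion⁻ {⁅ i ⁆} z∈arm-i)
    in S , ∣S∣≡k , (λ y∈Y → ∈-armUnion⁺ (B⊆S (∈-image⁺ arm y∈Y)))
         , z , ∈-armUnion⁺ (subst (_∈ S) (sym arm-z≡i) i∈S)
         , λ z∈Y → i∉B (subst (_∈ B) arm-z≡i (∈-image⁺ arm z∈Y))
    where
    B = image arm Y
    ∣B∣<k = ∣image∣<k Y Y-union ∣Y∣<2k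

  arms-meeting-only-at : ∀ {k Y e z} → e ∈ Y → arm z ≡ arm e → z ∉ Y → 1 ≤ k → ∣ Y ∣ + k ≤ suc m →
                         ∃ λ S → ∣ S ∣ ≡ k × arm e ∈ S × armUnion arm S - e ⊆ ∁ Y
  arms-meeting-only-at {k} {Y} {e} {z} e∈Y arm-z≡arm-e z∉Y 1≤k ∣Y∣+k≤1+m =
    let S , ⁅arm-e⁆⊆S , S⊆∁A , ∣S∣≡k =
          ⊆-extend k ⁅arm-e⁆⊆∁A (subst (_≤ k) (sym (∣⁅x⁆∣≡1 (arm e))) 1≤k) k≤∣∁A∣
    in S , ∣S∣≡k , ⁅arm-e⁆⊆S (x∈⁅x⁆ (arm e)) , λ x∈ → x∉p⇒x∈∁p (avoids S⊆∁A x∈)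
    where
    open ≤-Reasoning
    A = image arm Y - arm e
    arm-e∈image : arm e ∈ image arm Y
    arm-e∈image = ∈-image⁺ arm e∈Y
    ⁅arm-e⁆⊆∁A : ⁅ arm e ⁆ ⊆ ∁ A
    ⁅arm-e⁆⊆∁A i∈ = x∉p⇒x∈∁p λ i∈A → x∈p-y⇒x≢y i∈A (x∈⁅y⁆⇒x≡y _ i∈)
    k≤∣∁A∣ : k ≤ ∣ ∁ A ∣
    k≤∣∁A∣ = subst (k ≤_) (sym (∣∁p∣≡n∸∣p∣ A)) (m+n≤o⇒m≤o∸n k (s≤s⁻¹ (begin
      suc (k + ∣ A ∣)       ≡⟨ cong suc (+-comm k ∣ A ∣) ⟩
      suc ∣ A ∣ + k         ≡⟨ cong (_+ k) (x∈p⇒∣p∣≡1+∣p-x∣ arm-e∈image) ⟨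
      ∣ image arm Y ∣ + k   ≤⟨ +-monoˡ-≤ k (∣image∣≤∣p∣ arm Y) ⟩
      ∣ Y ∣ + k             ≤⟨ ∣Y∣+k≤1+m ⟩
      suc m                 ∎)))
    z≢e : z ≢ e
    z≢e z≡e = z∉Y (subst (_∈ Y) (sym z≡e) e∈Y)
    avoids : ∀ {S x} → S ⊆ ∁ A → x ∈ armUnion arm S - e → x ∉ Y
    avoids {S} {x} S⊆∁A x∈ x∈Y with arm x ≟ arm e
    ... | no arm-x≢arm-e = x∈∁p⇒x∉p (S⊆∁A (∈-armUnion⁻ {S} (p─q⊆p _ _ x∈)))
                                     (x∈p∧x≢y⇒x∈p-y (∈-image⁺ arm x∈Y) arm-x≢arm-e)
    ... | yes arm-x≡arm-e =
      z∉Y (subst (_∈ Y) (partner-unique arm-z≡arm-e arm-x≡arm-e z≢e (x∈p-y⇒x≢y x∈)) x∈Y)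

Independent : ∀ {n} → Matroid n → Subset n → Set
Independent M X = rank M X ≡ ∣ X ∣

Spanning : ∀ {n} → Matroid n → Subset n → Set
Spanning M X = rank M ⊤ ≤ rank M X

module _ {n} (M : Matroid n) where

  ⊂circuit⇒independent : ∀ {C Y} → IsCircuit M C → Y ⊂ C → Independent M Y
  ⊂circuit⇒independent (_ , proper⇒independent) Y⊂C =
    proper⇒independent _ (proj₁ Y⊂C) (λ Y≡C → ⊂-irref Y≡C Y⊂C)

  cocircuit⇒¬spanning-∁ : ∀ {D} → IsCocircuit M D → rank M (∁ D) < rank M ⊤
  cocircuit⇒¬spanning-∁ {D} (corank<∣D∣ , _) = m+n∸o<m⇒n<o ∣ D ∣ _ _ corank<∣D∣

  ⊂cocircuit⇒spanning-∁ : ∀ {D Z} → IsCocircuit M D → Z ⊂ D → Spanning M (∁ Z)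
  ⊂cocircuit⇒spanning-∁ {Z = Z} (_ , proper⇒coindependent) Z⊂D with nonempty? Z
  ... | yes (x , x∈Z) = m+n∸o≡m⇒o≤n ∣ Z ∣ _ _ (x∈p⇒0<∣p∣ x∈Z)
                          (proper⇒coindependent Z (proj₁ Z⊂D) (λ Z≡D → ⊂-irref Z≡D Z⊂D))
  ... | no Z-empty    = rank-mono M ⊤ (∁ Z) λ _ → x∉p⇒x∈∁p λ x∈Z → Z-empty (_ , x∈Z)

  circuit⇒rank≤rank[C-e] : ∀ {C e} → IsCircuit M C → e ∈ C → rank M C ≤ rank M (C - e)
  circuit⇒rank≤rank[C-e] {C} {e} C-circuit e∈C = begin
    rank M C        ≤⟨ s≤s⁻¹ (subst (rank M C <_) (x∈p⇒∣p∣≡1+∣p-x∣ e∈C) (proj₁ C-circuit)) ⟩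
    ∣ C - e ∣       ≡⟨ ⊂circuit⇒independent C-circuit (x∈p⇒p-x⊂p e∈C) ⟨
    rank M (C - e)  ∎
    where open ≤-Reasoning

  cocircuit⇒rank[Y-e]<rank[Y] : ∀ {D Y e} → IsCocircuit M D → e ∈ D → e ∈ Y → D - e ⊆ ∁ Y →
                                rank M (Y - e) < rank M Y
  cocircuit⇒rank[Y-e]<rank[Y] {D} {Y} {e} D-cocircuit e∈D e∈Y D-e⊆∁Y = +-cancelˡ-< (rank M ⊤) _ _ (begin-strict
    rank M ⊤ + rank M (Y - e)
      ≤⟨ +-monoˡ-≤ (rank M (Y - e)) (⊂cocircuit⇒spanning-∁ D-cocircuit (x∈p⇒p-x⊂p e∈D)) ⟩
    rank M (∁ (D - e)) + rank M (Y - e)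
      ≤⟨ +-mono-≤ (rank-mono M _ _ (∁[p-x]⊆∁p∪q e∈Y)) (rank-mono M _ _ Y-e⊆∁D∩Y) ⟩
    rank M (∁ D ∪ Y) + rank M (∁ D ∩ Y)
      ≤⟨ rank-submod M (∁ D) Y ⟩
    rank M (∁ D) + rank M Y
      <⟨ +-monoˡ-< (rank M Y) (cocircuit⇒¬spanning-∁ D-cocircuit) ⟩
    rank M ⊤ + rank M Y
      ∎)
    where
    open ≤-Reasoning
    Y-e⊆∁D∩Y : Y - e ⊆ ∁ D ∩ Y
    Y-e⊆∁D∩Y x∈ = x∈p∩q⁺ (p-x⊆∁q⇒q-x⊆∁p D-e⊆∁Y x∈ , p─q⊆p Y _ x∈)

  circuit⇒rank∁[Y-e]≤rank∁Y : ∀ {C Y e} → IsCircuit M C → e ∈ C → e ∈ Y → C - e ⊆ ∁ Y →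
                              rank M (∁ (Y - e)) ≤ rank M (∁ Y)
  circuit⇒rank∁[Y-e]≤rank∁Y {C} {Y} {e} C-circuit e∈C e∈Y C-e⊆∁Y = +-cancelʳ-≤ (rank M (C - e)) _ _ (begin
    rank M (∁ (Y - e)) + rank M (C - e)
      ≤⟨ +-mono-≤ (rank-mono M _ _ (∁[p-x]⊆∁p∪q e∈C)) (rank-mono M _ _ C-e⊆∁Y∩C) ⟩
    rank M (∁ Y ∪ C) + rank M (∁ Y ∩ C)
      ≤⟨ rank-submod M (∁ Y) C ⟩
    rank M (∁ Y) + rank M C
      ≤⟨ +-monoʳ-≤ (rank M (∁ Y)) (circuit⇒rank≤rank[C-e] C-circuit e∈C) ⟩
    rank M (∁ Y) + rank M (C - e)
      ∎)
    where
    open ≤-Reasoning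
    C-e⊆∁Y∩C : C - e ⊆ ∁ Y ∩ C
    C-e⊆∁Y∩C x∈ = x∈p∩q⁺ (C-e⊆∁Y x∈ , p─q⊆p C _ x∈)

module Spike {n s t m} {M : Matroid n} {arm : Fin n → Fin m} (spike : IsSpike s t m M arm) where
  open IsSpike spike
  open Arms arm
  open ArmPairs {arm = arm} arm-size

  small⇒independent : 1 ≤ t → ∀ {b} → b < 2 * s → b + t ≤ suc m → ∀ Y → ∣ Y ∣ ≤ b → Independent M Y
  small⇒independent 1≤t {b} b<2s b+t≤1+m = subset-induction _ step
    where
    open ≤-Reasoning
    step : ∀ Y → (∀ {e} → e ∈ Y → ∣ Y - e ∣ ≤ b → Independent M (Y - e)) → ∣ Y ∣ ≤ b → Independent M Y
    step Y ih ∣Y∣≤b with unionOfArms⊎splitsArm Y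
    ... | inj₁ Y-union =
      let S , ∣S∣≡s , Y⊂C = unionOfArms⊂armUnion Y Y-union (≤-<-trans ∣Y∣≤b b<2s) s≤m
      in ⊂circuit⇒independent M (circuits S ∣S∣≡s) Y⊂C
    ... | inj₂ (e , e∈Y , z , arm-z≡arm-e , z∉Y) =
      let S , ∣S∣≡t , arm-e∈S , D-e⊆∁Y =
            arms-meeting-only-at e∈Y arm-z≡arm-e z∉Y 1≤t (≤-trans (+-monoˡ-≤ t ∣Y∣≤b) b+t≤1+m)
          e∈D = ∈-armUnion⁺ arm-e∈S
      in ≤-antisym (rank-bound M Y) (begin
        ∣ Y ∣                 ≡⟨ x∈p⇒∣p∣≡1+∣p-x∣ e∈Y ⟩
        suc ∣ Y - e ∣         ≡⟨ cong suc (ih e∈Y (≤-trans (∣p─q∣≤∣p∣ Y _) ∣Y∣≤b)) ⟨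
        suc (rank M (Y - e))  ≤⟨ cocircuit⇒rank[Y-e]<rank[Y] M (cocircuits S ∣S∣≡t) e∈D e∈Y D-e⊆∁Y ⟩
        rank M Y              ∎)

  small⇒coindependent : 1 ≤ s → ∀ {b} → b < 2 * t → b + s ≤ suc m → ∀ Y → ∣ Y ∣ ≤ b → Spanning M (∁ Y)
  small⇒coindependent 1≤s {b} b<2t b+s≤1+m = subset-induction _ step
    where
    step : ∀ Y → (∀ {e} → e ∈ Y → ∣ Y - e ∣ ≤ b → Spanning M (∁ (Y - e))) → ∣ Y ∣ ≤ b → Spanning M (∁ Y)
    step Y ih ∣Y∣≤b with unionOfArms⊎splitsArm Y
    ... | inj₁ Y-union =
      let S , ∣S∣≡t , Y⊂D = unionOfArms⊂armUnion Y Y-union (≤-<-trans ∣Y∣≤b b<2t) t≤m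
      in ⊂cocircuit⇒spanning-∁ M (cocircuits S ∣S∣≡t) Y⊂D
    ... | inj₂ (e , e∈Y , z , arm-z≡arm-e , z∉Y) =
      let S , ∣S∣≡s , arm-e∈S , C-e⊆∁Y =
            arms-meeting-only-at e∈Y arm-z≡arm-e z∉Y 1≤s (≤-trans (+-monoˡ-≤ s ∣Y∣≤b) b+s≤1+m)
      in ≤-trans (ih e∈Y (≤-trans (∣p─q∣≤∣p∣ Y _) ∣Y∣≤b))
                 (circuit⇒rank∁[Y-e]≤rank∁Y M (circuits S ∣S∣≡s) (∈-armUnion⁺ arm-e∈S) e∈Y C-e⊆∁Y)

lemma5p7 : ∀ {n : ℕ} (s t m : ℕ) → 1 ≤ s → 1 ≤ t
    → (M : Matroid n) (arm : Fin n → Fin m) → IsSpike s t m M arm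
    → 3 * (s ⊔ t) ∸ 2 ≤ m
    → (X : Subset n) → ∣ X ∣ ≤ 2 * (s ⊓ t) ∸ 1
    → conn M X ≡ ∣ X ∣
lemma5p7 s t m 1≤s 1≤t M arm spike 3max-2≤m X ∣X∣≤2min-1 = begin
  rank M X + rank M (∁ X) ∸ rank M ⊤  ≡⟨ cong₂ (λ a c → a + c ∸ rank M ⊤) X-independent X-coindependent ⟩
  ∣ X ∣ + rank M ⊤ ∸ rank M ⊤         ≡⟨ m+n∸n≡m ∣ X ∣ (rank M ⊤) ⟩
  ∣ X ∣                               ∎
  where
  open ≡-Reasoning
  open Spike spike
  1≤min = ⊓-glb 1≤s 1≤t
  bounds-s = size-bounds 1≤min (m⊓n≤m s t) (m⊓n≤m⊔n s t) (m≤n⊔m s t) 3max-2≤m ∣X∣≤2min-1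
  bounds-t = size-bounds 1≤min (m⊓n≤n s t) (m⊓n≤m⊔n s t) (m≤m⊔n s t) 3max-2≤m ∣X∣≤2min-1
  X-independent : rank M X ≡ ∣ X ∣
  X-independent = small⇒independent 1≤t (proj₁ bounds-s) (proj₂ bounds-s) X ≤-refl
  X-coindependent : rank M (∁ X) ≡ rank M ⊤
  X-coindependent = ≤-antisym (rank-mono M (∁ X) ⊤ ⊆⊤)
                              (small⇒coindependent 1≤s (proj₁ bounds-t) (proj₂ bounds-t) X ≤-refl)
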